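{- A binary De Morgan function is a protoimplication if and only if it lies in the interval $[x\leftrightarrow_{\mathrm{t\text-min}}y,\ x\rightarrow_{\mathrm{t\text-max}}y]$ of the pointwise truth order, and equivalently if and only if it lies in the interval $[x\leftrightarrow_{\mathrm{i\text-min}}y,\ x\rightarrow_{\mathrm{i\text-max}}y]$ of the pointwise information order.
   Context: Let $\mathrm{DM}_4=\{\mathsf t,\mathsf f,\mathsf n,\mathsf b\}$. The truth order $\le$ has $\mathsf f$ least, $\mathsf t$ greatest, $\mathsf n,\mathsf b$ incomparable. The information order $\sqsubseteq$ has $\mathsf n$ least, $\mathsf b$ greatest, $\mathsf t,\mathsf f$ incomparable. Binary De Morgan functions are maps $\mathrm{DM}_4^2\to\mathrm{DM}_4$, ordered pointwise. A binary De Morgan function $\rightarrow$ is a protoimplication if $a\rightarrow a\in\{\mathsf t,\mathsf b\}$ for all $a$, and $a\in\{\mathsf t,\mathsf b\}$ together with $a\rightarrow b\in\{\mathsf t,\mathsf b\}$ implies $b\in\{\mathsf t,\mathsf b\}$. The four functions are: $a\rightarrow_{\mathrm{t\text-max}}b=\mathsf n$ if $a\in\{\mathsf t,\mathsf b\}$ and $b\in\{\mathsf f,\mathsf n\}$, and $=\mathsf t$ otherwise; $a\rightarrow_{\mathrm{i\text-max}}b=\mathsf f$ if $a\in\{\mathsf t,\mathsf b\}$ and $b\in\{\mathsf f,\mathsf n\}$, and $=\mathsf b$ otherwise; $a\leftrightarrow_{\mathrm{t\text-min}}b=\mathsf b$ if $a=b$ and $\mathsf f$ otherwise; $a\leftrightarrow_{\mathrm{i\text-min}}b=\mathsf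 t$ if $a=b$ and $\mathsf n$ otherwise. -}

module Defs where

open import Data.Product using (_×_; _,_)
open import Relation.Binary.PropositionalEquality using (_≡_; refl)

data DM4 : Set where
  t f n b : DM4

data _≤t_ : DM4 → DM4 → Set where
  ≤t-refl : ∀ {a} → a ≤t a
  f≤t     : ∀ {a} → f ≤t a
  ≤t-t    : ∀ {a} → a ≤t t

data _⊑_ : DM4 → DM4 → Set where
  ⊑-refl : ∀ {a} → a ⊑ a
  n⊑     : ∀ {a} → n ⊑ a
  ⊑-b    : ∀ {a} → a ⊑ b

data Designated : DM4 → Set where
  des-t : Designated t
  des-b : Designated b

BinFun : Set
BinFun = DM4 → DM4 → DM4

IsProtoimplication : BinFun → Set
IsProtoimplication _⇒_ =
  (∀ a → Designated (a ⇒ a)) ×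
  (∀ a c → Designated a → Designated (a ⇒ c) → Designated c)

_≤ṫ_ : BinFun → BinFun → Set
g ≤ṫ h = ∀ x y → g x y ≤t h x y

_⊑̇_ : BinFun → BinFun → Set
g ⊑̇ h = ∀ x y → g x y ⊑ h x y

→tmax : BinFun
→tmax t f = n
→tmax t n = n
→tmax b f = n
→tmax b n = n
→tmax _ _ = t

→imax : BinFun
→imax t f = f
→imax t n = f
→imax b f = f
→imax b n = f
→imax _ _ = b

↔tmin : BinFun
↔tmin t t = b
↔tmin f f = b
↔tmin n n = b
↔tmin b b = b
↔tmin _ _ = f

↔imin : BinFun
↔imin t t = t
↔imin f f = t
↔imin n n = t
↔imin b b = t
↔imin _ _ = n

-- Being a protoimplication constrains each value x ⇒ y separately: it must be designated
-- when x = y, undesignated when x is designated and y is not, and is unconstrained otherwise.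
-- On the corresponding pairs the bounds of the truth interval are b ≤ t, f ≤ n and f ≤ t,
-- those of the information interval t ⊑ b, n ⊑ f and n ⊑ b; these intervals are exactly
-- {t, b}, {f, n} and all of DM4, so at every point both intervals consist of the admissible values.
module Submission where

open import Data.Empty using (⊥-elim)
open import Data.Product using (_×_; _,_; proj₁; proj₂)
open import Function.Bundles using (_⇔_; mk⇔; Equivalence)
open import Function.Properties.Equivalence using () renaming (trans to ⇔-trans)
open import Relation.Binary.PropositionalEquality using (_≡_; _≢_; refl)
open import Relation.Nullary using (¬_)

open import Defs

open Equivalence using (to; from)

Admissible : DM4 → DM4 → DM4 → Set
Admissible x y v = (x ≡ y → Designated v) × (Designated x → Designated v → Designated y)

isProtoimplication⇔admissible : (g : BinFun) →
  IsProtoimplication g ⇔ (∀ x y → Admissible x y (g x y))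
isProtoimplication⇔admissible g = mk⇔
  (λ (reflexive , detachment) x y → (λ { refl → reflexive x }) , detachment x y)
  (λ admissible → (λ x → proj₁ (admissible x x) refl) , (λ x y → proj₂ (admissible x y)))

admissible-diagonal : ∀ {a v} → Admissible a a v ⇔ Designated v
admissible-diagonal = mk⇔ (λ (diagonal , _) → diagonal refl) (λ dv → (λ _ → dv) , (λ da _ → da))

admissible-refuting : ∀ {a c v} → Designated a → ¬ Designated c →
  Admissible a c v ⇔ (¬ Designated v)
admissible-refuting da ¬dc = mk⇔
  (λ (_ , detachment) dv → ¬dc (detachment da dv))
  (λ ¬dv → (λ { refl → ⊥-elim (¬dc da) }) , (λ _ dv → ⊥-elim (¬dv dv)))

admissible-neutral : ∀ {a c v} → a ≢ c → (Designated a → Designated c) → Admissible a c v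
admissible-neutral a≢c da⇒dc = (λ a≡c → ⊥-elim (a≢c a≡c)) , (λ da _ → da⇒dc da)

Between : (DM4 → DM4 → Set) → DM4 → DM4 → DM4 → Set
Between _≼_ lo hi v = lo ≼ v × v ≼ hi

protoimplication⇔between : (_≼_ : DM4 → DM4 → Set) (lo hi : BinFun) →
  (∀ x y v → Admissible x y v ⇔ Between _≼_ (lo x y) (hi x y) v) →
  (g : BinFun) →
  IsProtoimplication g ⇔ ((∀ x y → lo x y ≼ g x y) × (∀ x y → g x y ≼ hi x y))
protoimplication⇔between _≼_ lo hi admissible⇔between g =
  ⇔-trans (isProtoimplication⇔admissible g) (mk⇔
    (λ admissible → (λ x y → proj₁ (between (admissible x y)))
                  , (λ x y → proj₂ (between (admissible x y))))
    (λ (lower , upper) x y → from (admissible⇔between x y (g x y)) (lower x y , upper x y)))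
  where
  between : ∀ {x y} → Admissible x y (g x y) → Between _≼_ (lo x y) (hi x y) (g x y)
  between {x} {y} = to (admissible⇔between x y (g x y))

designated⇔between-b-t : ∀ {v} → Designated v ⇔ Between _≤t_ b t v
designated⇔between-b-t = mk⇔
  (λ { des-t → ≤t-t , ≤t-refl ; des-b → ≤t-refl , ≤t-t })
  (λ { (≤t-refl , _) → des-b ; (≤t-t , _) → des-t })

undesignated⇔between-f-n : ∀ {v} → (¬ Designated v) ⇔ Between _≤t_ f n v
undesignated⇔between-f-n {t} = mk⇔ (λ ¬dv → ⊥-elim (¬dv des-t)) (λ { (_ , ()) })
undesignated⇔between-f-n {f} = mk⇔ (λ _ → ≤t-refl , f≤t) (λ _ ())
undesignated⇔between-f-n {n} = mk⇔ (λ _ → f≤t , ≤t-refl) (λ _ ())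
undesignated⇔between-f-n {b} = mk⇔ (λ ¬dv → ⊥-elim (¬dv des-b)) (λ { (_ , ()) })

admissible⇔between-↔tmin-→tmax : ∀ x y v → Admissible x y v ⇔ Between _≤t_ (↔tmin x y) (→tmax x y) v
admissible⇔between-↔tmin-→tmax x y v = table x y
  where
  diagonal : ∀ {a} → Admissible a a v ⇔ Between _≤t_ b t v
  diagonal = ⇔-trans admissible-diagonal designated⇔between-b-t

  refuting : ∀ {a c} → Designated a → ¬ Designated c → Admissible a c v ⇔ Between _≤t_ f n v
  refuting da ¬dc = ⇔-trans (admissible-refuting da ¬dc) undesignated⇔between-f-n

  neutral : ∀ {a c} → a ≢ c → (Designated a → Designated c) → Admissible a c v ⇔ Between _≤t_ f t v
  neutral a≢c da⇒dc = mk⇔ (λ _ → f≤t , ≤t-t) (λ _ → admissible-neutral a≢c da⇒dc)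

  table : ∀ x y → Admissible x y v ⇔ Between _≤t_ (↔tmin x y) (→tmax x y) v
  table t t = diagonal
  table t f = refuting des-t λ ()
  table t n = refuting des-t λ ()
  table t b = neutral (λ ()) (λ _ → des-b)
  table f t = neutral (λ ()) λ ()
  table f f = diagonal
  table f n = neutral (λ ()) λ ()
  table f b = neutral (λ ()) λ ()
  table n t = neutral (λ ()) λ ()
  table n f = neutral (λ ()) λ ()
  table n n = diagonal
  table n b = neutral (λ ()) λ ()
  table b t = neutral (λ ()) (λ _ → des-t)
  table b f = refuting des-b λ ()
  table b n = refuting des-b λ ()
  table b b = diagonal

designated⇔between-t-b : ∀ {v} → Designated v ⇔ Between _⊑_ t b v
designated⇔between-t-b = mk⇔
  (λ { des-t → ⊑-refl , ⊑-b ; des-b → ⊑-b , ⊑-refl })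
  (λ { (⊑-refl , _) → des-t ; (⊑-b , _) → des-b })

undesignated⇔between-n-f : ∀ {v} → (¬ Designated v) ⇔ Between _⊑_ n f v
undesignated⇔between-n-f {t} = mk⇔ (λ ¬dv → ⊥-elim (¬dv des-t)) (λ { (_ , ()) })
undesignated⇔between-n-f {f} = mk⇔ (λ _ → n⊑ , ⊑-refl) (λ _ ())
undesignated⇔between-n-f {n} = mk⇔ (λ _ → ⊑-refl , n⊑) (λ _ ())
undesignated⇔between-n-f {b} = mk⇔ (λ ¬dv → ⊥-elim (¬dv des-b)) (λ { (_ , ()) })

admissible⇔between-↔imin-→imax : ∀ x y v → Admissible x y v ⇔ Between _⊑_ (↔imin x y) (→imax x y) v
admissible⇔between-↔imin-→imax x y v = table x y
  where
  diagonal : ∀ {a} → Admissible a a v ⇔ Between _⊑_ t b v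
  diagonal = ⇔-trans admissible-diagonal designated⇔between-t-b

  refuting : ∀ {a c} → Designated a → ¬ Designated c → Admissible a c v ⇔ Between _⊑_ n f v
  refuting da ¬dc = ⇔-trans (admissible-refuting da ¬dc) undesignated⇔between-n-f

  neutral : ∀ {a c} → a ≢ c → (Designated a → Designated c) → Admissible a c v ⇔ Between _⊑_ n b v
  neutral a≢c da⇒dc = mk⇔ (λ _ → n⊑ , ⊑-b) (λ _ → admissible-neutral a≢c da⇒dc)

  table : ∀ x y → Admissible x y v ⇔ Between _⊑_ (↔imin x y) (→imax x y) v
  table t t = diagonal
  table t f = refuting des-t λ ()
  table t n = refuting des-t λ ()
  table t b = neutral (λ ()) (λ _ → des-b)
  table f t = neutral (λ ()) λ ()
  table f f = diagonal
  table f n = neutral (λ ()) λ ()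
  table f b = neutral (λ ()) λ ()
  table n t = neutral (λ ()) λ ()
  table n f = neutral (λ ()) λ ()
  table n n = diagonal
  table n b = neutral (λ ()) λ ()
  table b t = neutral (λ ()) (λ _ → des-t)
  table b f = refuting des-b λ ()
  table b n = refuting des-b λ ()
  table b b = diagonal

mainTheorem12 : (_⇒_ : BinFun) →
    (IsProtoimplication _⇒_ ⇔ (↔tmin ≤ṫ _⇒_ × _⇒_ ≤ṫ →tmax))
    × (IsProtoimplication _⇒_ ⇔ (↔imin ⊑̇ _⇒_ × _⇒_ ⊑̇ →imax))
mainTheorem12 _⇒_ =
    protoimplication⇔between _≤t_ ↔tmin →tmax admissible⇔between-↔tmin-→tmax _⇒_
  , protoimplication⇔between _⊑_ ↔imin →imax admissible⇔between-↔imin-→imax _⇒_
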